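{- For all positive integers $n$ and $k$, $f_1(n,k)=\binom{n-1}{k-1}$.
   Context: The triangle $T_m$ (rotation number $m$) is the array whose row $x$ ($x=1,2,\dots$) has $x$ entries in columns $0,\dots,x-1$, defined by $T_m(1,0)=1$; for $x>1$ and $0\le c\le x-2$, $T_m(x,c)=T_m(x-1,c+m)$; and $T_m(x,x-1)=1+T_m(x-1,0)$, where $T_m(x,c)$ for any integer $c$ denotes the entry in row $x$, column ($c$ mod $x$). Let $a_m(n)=\min\{x\in\mathbb{N}: T_m(x,x-1)=n\}$ (the row in which $n$ first appears), and let $f_m(n,k)$ be the number of entries equal to $k$ in row $a_m(n)$ of $T_m$. -}

module Defs where

open import Data.Nat using (ℕ; zero; suc; _+_; _∸_; _<_; _≤_; _≟_)
open import Data.Nat.DivMod using (_%_)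
open import Data.Fin using (Fin; toℕ; fromℕ<; inject₁; fromℕ)
open import Data.Nat.DivMod using (m%n<n)
open import Data.Vec using (Vec; _∷_; []; lookup; tabulate; count; _∷ʳ_)
open import Relation.Binary.PropositionalEquality using (_≡_)
open import Relation.Nullary using (¬_)
open import Data.Product using (_×_)

-- rowV m y : row number (suc y) of the triangle T_m, as a vector of length suc y
-- (position i of the vector is column i).
rowV : ℕ → (y : ℕ) → Vec ℕ (suc y)
rowV m zero    = 1 ∷ []
rowV m (suc y) =
  tabulate (λ (c : Fin (suc y)) →
              lookup (rowV m y) (fromℕ< (m%n<n (toℕ c + m) (suc y))))
  ∷ʳ (1 + lookup (rowV m y) Data.Fin.zero)


-- Row x of T_m (x ≥ 1); row 0 does not exist, we return the empty vector.
row : ℕ → (x : ℕ) → Vec ℕ x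
row m zero    = []
row m (suc y) = rowV m y

T : ℕ → (x : ℕ) → ℕ → ℕ
T m zero    c = 0
T m (suc y) c = lookup (rowV m y) (fromℕ< (m%n<n c (suc y)))

IsFirstRow : ℕ → ℕ → ℕ → Set
IsFirstRow m n x =
  1 ≤ x × T m x (x ∸ 1) ≡ n
  × (∀ y → 1 ≤ y → y < x → ¬ (T m y (y ∸ 1) ≡ n))

countRow : ℕ → ℕ → ℕ → ℕ
countRow m x k = count (_≟ k) (row m x)

-- For rotation number 1 the passage from one row to the next takes the first
-- entry h off the front of the row and appends h and h + 1 at the back, so the
-- rows behave like a queue. Feeding a row of length 2^j through the queue once
-- replaces each entry v by the pair v, v + 1; starting from the row [1], the row
-- of length 2^j is therefore the j-fold doubling of [1]. Doubling turns the
-- number of entries equal to k + 1 into the Pascal recurrence. The j-fold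
-- doubling ends in j + 1 and all its other entries are at most j; the rows
-- strictly between length 2^j and 2^(j+1) arise while the queue consumes those
-- other entries, so they never contain anything larger than j + 1.
module Submission where

open import Defs
open import Data.Nat using (ℕ; _∸_; _≤_)
open import Data.Nat.Combinatorics using (_C_)
open import Data.Product using (∃-syntax; _×_)
open import Relation.Binary.PropositionalEquality using (_≡_)

open import Data.Bool using (true; false; if_then_else_)
open import Data.Empty using (⊥-elim)
open import Data.Fin using (Fin; toℕ; fromℕ<; fromℕ) renaming (zero to fzero; suc to fsuc)
open import Data.Fin.Properties using (toℕ-injective; toℕ-fromℕ<; toℕ-fromℕ; toℕ≤pred[n])
open import Data.List using (List; []; _∷_; [_]; _++_; length)
open import Data.List.Properties using (++-assoc; ++-identityʳ; length-++; ∷-injectiveʳ)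
open import Data.List.Relation.Unary.All as All using (All; []; _∷_)
open import Data.List.Relation.Unary.All.Properties using (++⁺)
open import Data.Nat using (zero; suc; _+_; _^_; _<_; _≡ᵇ_; _<?_; z≤n; s≤s)
open import Data.Nat.Combinatorics using (nCk+nC[k+1]≡[n+1]C[k+1])
open import Data.Nat.DivMod using (_%_; m%n<n; n%n≡0; m<n⇒m%n≡m)
open import Data.Nat.GeneralisedArithmetic using (iterate)
open import Data.Nat.Properties
open import Data.Product using (_,_)
open import Data.Vec as Vec using (Vec; lookup; tabulate; count; toList; _∷ʳ_)
open import Data.Vec.Properties using (toList-∷ʳ; tabulate-cong; tabulate∘lookup)
open import Data.Vec.Relation.Unary.All.Properties using (lookup⁺; toList⁻)
open import Relation.Binary.Definitions using (tri<; tri≈; tri>)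
open import Relation.Binary.PropositionalEquality
  using (refl; sym; trans; cong; cong₂; subst; subst₂; module ≡-Reasoning)
open import Relation.Nullary using (¬_; yes; no)

advance : List ℕ → List ℕ
advance []      = []
advance (h ∷ t) = t ++ h ∷ suc h ∷ []

double : List ℕ → List ℕ
double []       = []
double (v ∷ vs) = v ∷ suc v ∷ double vs

doubling : ℕ → List ℕ
doubling zero    = [ 1 ]
doubling (suc j) = double (doubling j)

occurrences : ℕ → List ℕ → ℕ
occurrences k []       = 0
occurrences k (x ∷ xs) = if x ≡ᵇ k then suc (occurrences k xs) else occurrences k xs

iterate-advance-++ : ∀ xs ys → iterate advance (xs ++ ys) (length xs) ≡ ys ++ double xs
iterate-advance-++ []       ys = sym (++-identityʳ ys)
iterate-advance-++ (x ∷ xs) ys = begin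
  iterate advance ((xs ++ ys) ++ x ∷ suc x ∷ []) (length xs)
    ≡⟨ cong (λ q → iterate advance q (length xs)) (++-assoc xs ys _) ⟩
  iterate advance (xs ++ ys ++ x ∷ suc x ∷ []) (length xs)
    ≡⟨ iterate-advance-++ xs (ys ++ x ∷ suc x ∷ []) ⟩
  (ys ++ x ∷ suc x ∷ []) ++ double xs
    ≡⟨ ++-assoc ys _ (double xs) ⟩
  ys ++ double (x ∷ xs)
    ∎
  where open ≡-Reasoning

iterate-advance-bounded : ∀ {j} i xs ys → i ≤ length xs → All (_≤ j) xs → All (_≤ suc j) ys →
                          All (_≤ suc j) (iterate advance (xs ++ ys) i)
iterate-advance-bounded zero    xs       ys _         xs≤j         ys≤1+j =
  ++⁺ (All.map m≤n⇒m≤1+n xs≤j) ys≤1+j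
iterate-advance-bounded (suc i) (x ∷ xs) ys (s≤s i≤n) (x≤j ∷ xs≤j) ys≤1+j =
  subst (λ q → All _ (iterate advance q i)) (sym (++-assoc xs ys _))
    (iterate-advance-bounded i xs (ys ++ x ∷ suc x ∷ []) i≤n xs≤j
      (++⁺ ys≤1+j (m≤n⇒m≤1+n x≤j ∷ s≤s x≤j ∷ [])))

length-double : ∀ xs → length (double xs) ≡ length xs + length xs
length-double []       = refl
length-double (x ∷ xs) =
  cong suc (trans (cong suc (length-double xs)) (sym (+-suc (length xs) (length xs))))

length-doubling : ∀ j → length (doubling j) ≡ 2 ^ j
length-doubling zero    = refl
length-doubling (suc j) = begin
  length (double (doubling j))                 ≡⟨ length-double (doubling j) ⟩
  length (doubling j) + length (doubling j)    ≡⟨ cong₂ _+_ (length-doubling j) (length-doubling j) ⟩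
  2 ^ j + 2 ^ j                                ≡⟨ cong (2 ^ j +_) (sym (+-identityʳ (2 ^ j))) ⟩
  2 ^ suc j                                    ∎
  where open ≡-Reasoning

double-++ : ∀ xs ys → double (xs ++ ys) ≡ double xs ++ double ys
double-++ []       ys = refl
double-++ (x ∷ xs) ys = cong (λ r → x ∷ suc x ∷ r) (double-++ xs ys)

double-bounded : ∀ {j} xs → All (_≤ j) xs → All (_≤ suc j) (double xs)
double-bounded []       []           = []
double-bounded (x ∷ xs) (x≤j ∷ xs≤j) = m≤n⇒m≤1+n x≤j ∷ s≤s x≤j ∷ double-bounded xs xs≤j

doubling-∷ʳ : ∀ j → ∃[ init ] (doubling j ≡ init ++ [ suc j ] × All (_≤ j) init)
doubling-∷ʳ zero = [] , refl , []
doubling-∷ʳ (suc j) with doubling-∷ʳ j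
... | init , eq , init≤j =
  double init ++ [ suc j ] ,
  trans (cong double eq)
    (trans (double-++ init [ suc j ]) (sym (++-assoc (double init) [ suc j ] [ suc (suc j) ]))) ,
  ++⁺ (double-bounded init init≤j) (≤-refl ∷ [])

occurrences-double : ∀ k xs →
                     occurrences (suc k) (double xs) ≡ occurrences (suc k) xs + occurrences k xs
occurrences-double k []       = refl
occurrences-double k (x ∷ xs) with x ≡ᵇ suc k | x ≡ᵇ k
... | true  | true  = cong suc (trans (cong suc (occurrences-double k xs)) (sym (+-suc _ _)))
... | true  | false = cong suc (occurrences-double k xs)
... | false | true  = trans (cong suc (occurrences-double k xs)) (sym (+-suc _ _))
... | false | false = occurrences-double k xs

occurrences-zero-double : ∀ xs → occurrences 0 (double xs) ≡ occurrences 0 xs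
occurrences-zero-double []       = refl
occurrences-zero-double (x ∷ xs) with x ≡ᵇ 0
... | true  = cong suc (occurrences-zero-double xs)
... | false = occurrences-zero-double xs

occurrences-zero-doubling : ∀ j → occurrences 0 (doubling j) ≡ 0
occurrences-zero-doubling zero    = refl
occurrences-zero-doubling (suc j) =
  trans (occurrences-zero-double (doubling j)) (occurrences-zero-doubling j)

occurrences-doubling : ∀ j k → occurrences (suc k) (doubling j) ≡ j C k
occurrences-doubling zero    zero    = refl
occurrences-doubling zero    (suc k) = refl
occurrences-doubling (suc j) zero    =
  trans (occurrences-double 0 (doubling j))
    (cong₂ _+_ (occurrences-doubling j 0) (occurrences-zero-doubling j))
occurrences-doubling (suc j) (suc k) = begin
  occurrences (suc (suc k)) (double (doubling j))
    ≡⟨ occurrences-double (suc k) (doubling j) ⟩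
  occurrences (suc (suc k)) (doubling j) + occurrences (suc k) (doubling j)
    ≡⟨ cong₂ _+_ (occurrences-doubling j (suc k)) (occurrences-doubling j k) ⟩
  j C suc k + j C k
    ≡⟨ +-comm (j C suc k) (j C k) ⟩
  j C k + j C suc k
    ≡⟨ nCk+nC[k+1]≡[n+1]C[k+1] j k ⟩
  suc j C suc k
    ∎
  where open ≡-Reasoning

lookup-toℕ-cong : ∀ {y} (v : Vec ℕ y) {i j : Fin y} → toℕ i ≡ toℕ j → lookup v i ≡ lookup v j
lookup-toℕ-cong v eq = cong (lookup v) (toℕ-injective eq)

lookup-∷ʳ-last : ∀ {y} (t : Vec ℕ y) h (c : Fin (suc y)) → toℕ c ≡ y → lookup (t ∷ʳ h) c ≡ h
lookup-∷ʳ-last Vec.[]      h fzero    _  = refl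
lookup-∷ʳ-last (x Vec.∷ t) h (fsuc c) eq = lookup-∷ʳ-last t h c (suc-injective eq)

lookup-∷ʳ-init : ∀ {y} (t : Vec ℕ y) h (c : Fin (suc y)) (c<y : toℕ c < y) →
                 lookup (t ∷ʳ h) c ≡ lookup t (fromℕ< c<y)
lookup-∷ʳ-init (x Vec.∷ t) h fzero    _         = refl
lookup-∷ʳ-init (x Vec.∷ t) h (fsuc c) (s≤s c<y) = lookup-∷ʳ-init t h c c<y

lookup-rotate : ∀ {y} h (t : Vec ℕ y) (c : Fin (suc y)) →
                lookup (h Vec.∷ t) (fromℕ< (m%n<n (toℕ c + 1) (suc y))) ≡ lookup (t ∷ʳ h) c
lookup-rotate {y} h t c with <-cmp (toℕ c) y
... | tri< c<y _ _ = trans (lookup-toℕ-cong (h Vec.∷ t) index) (sym (lookup-∷ʳ-init t h c c<y))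
  where
  index : toℕ (fromℕ< (m%n<n (toℕ c + 1) (suc y))) ≡ suc (toℕ (fromℕ< c<y))
  index = begin
    toℕ (fromℕ< (m%n<n (toℕ c + 1) (suc y))) ≡⟨ toℕ-fromℕ< _ ⟩
    (toℕ c + 1) % suc y                      ≡⟨ m<n⇒m%n≡m (subst (_< suc y) (+-comm 1 (toℕ c)) (s≤s c<y)) ⟩
    toℕ c + 1                                ≡⟨ +-comm (toℕ c) 1 ⟩
    suc (toℕ c)                              ≡⟨ cong suc (toℕ-fromℕ< c<y) ⟨
    suc (toℕ (fromℕ< c<y))                   ∎
    where open ≡-Reasoning
... | tri≈ _ c≡y _ = trans (lookup-toℕ-cong (h Vec.∷ t) index) (sym (lookup-∷ʳ-last t h c c≡y))
  where
  index : toℕ (fromℕ< (m%n<n (toℕ c + 1) (suc y))) ≡ 0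
  index = begin
    toℕ (fromℕ< (m%n<n (toℕ c + 1) (suc y))) ≡⟨ toℕ-fromℕ< _ ⟩
    (toℕ c + 1) % suc y                      ≡⟨ cong (_% suc y) (trans (+-comm (toℕ c) 1) (cong suc c≡y)) ⟩
    suc y % suc y                            ≡⟨ n%n≡0 (suc y) ⟩
    0                                        ∎
    where open ≡-Reasoning
... | tri> _ _ c>y = ⊥-elim (<⇒≱ c>y (toℕ≤pred[n] c))

rowList : ℕ → List ℕ
rowList y = toList (rowV 1 y)

rowList-suc : ∀ y → rowList (suc y) ≡ advance (rowList y)
rowList-suc y with rowV 1 y
... | h Vec.∷ t = begin
  toList (tabulate rotated ∷ʳ suc h)
    ≡⟨ toList-∷ʳ (suc h) (tabulate rotated) ⟩
  toList (tabulate rotated) ++ [ suc h ]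
    ≡⟨ cong (λ v → toList v ++ [ suc h ]) (tabulate-cong (lookup-rotate h t)) ⟩
  toList (tabulate (lookup (t ∷ʳ h))) ++ [ suc h ]
    ≡⟨ cong (λ v → toList v ++ [ suc h ]) (tabulate∘lookup (t ∷ʳ h)) ⟩
  toList (t ∷ʳ h) ++ [ suc h ]
    ≡⟨ cong (_++ [ suc h ]) (toList-∷ʳ h t) ⟩
  (toList t ++ [ h ]) ++ [ suc h ]
    ≡⟨ ++-assoc (toList t) [ h ] [ suc h ] ⟩
  advance (toList (h Vec.∷ t))
    ∎
  where
  open ≡-Reasoning
  rotated : Fin (suc _) → ℕ
  rotated c = lookup (h Vec.∷ t) (fromℕ< (m%n<n (toℕ c + 1) (suc _)))

rowList-+ : ∀ y i → rowList (y + i) ≡ iterate advance (rowList y) i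
rowList-+ y zero    = cong rowList (+-identityʳ y)
rowList-+ y (suc i) = begin
  rowList (y + suc i)                     ≡⟨ cong rowList (+-suc y i) ⟩
  rowList (suc y + i)                     ≡⟨ rowList-+ (suc y) i ⟩
  iterate advance (rowList (suc y)) i     ≡⟨ cong (λ q → iterate advance q i) (rowList-suc y) ⟩
  iterate advance (advance (rowList y)) i ∎
  where open ≡-Reasoning

rowList-doubling : ∀ j → rowList (2 ^ j ∸ 1) ≡ doubling j
rowList-doubling zero    = refl
rowList-doubling (suc j) = begin
  rowList (2 ^ suc j ∸ 1)
    ≡⟨ cong rowList (pow-split (2 ^ j) (m^n>0 2 j)) ⟩
  rowList ((2 ^ j ∸ 1) + 2 ^ j)
    ≡⟨ rowList-+ (2 ^ j ∸ 1) (2 ^ j) ⟩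
  iterate advance (rowList (2 ^ j ∸ 1)) (2 ^ j)
    ≡⟨ cong₂ (iterate advance) (trans (rowList-doubling j) (sym (++-identityʳ _))) (sym (length-doubling j)) ⟩
  iterate advance (doubling j ++ []) (length (doubling j))
    ≡⟨ iterate-advance-++ (doubling j) [] ⟩
  doubling (suc j)
    ∎
  where
  open ≡-Reasoning
  pow-split : ∀ p → 0 < p → p + (p + 0) ∸ 1 ≡ (p ∸ 1) + p
  pow-split (suc q) _ = cong (q +_) (+-identityʳ (suc q))

rowList-bounded-level : ∀ j i → i < 2 ^ j → All (_≤ suc j) (rowList ((2 ^ j ∸ 1) + i))
rowList-bounded-level j i i<2^j with doubling-∷ʳ j
... | init , eq , init≤j =
  subst (All (_≤ suc j)) (sym row≡) (iterate-advance-bounded i init [ suc j ] i≤init init≤j (≤-refl ∷ []))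
  where
  row≡ : rowList ((2 ^ j ∸ 1) + i) ≡ iterate advance (init ++ [ suc j ]) i
  row≡ = trans (rowList-+ (2 ^ j ∸ 1) i) (cong (λ q → iterate advance q i) (trans (rowList-doubling j) eq))
  length≡ : length init + 1 ≡ 2 ^ j
  length≡ = trans (sym (length-++ init)) (trans (cong length (sym eq)) (length-doubling j))
  i≤init : i ≤ length init
  i≤init = +-cancelʳ-≤ 1 i (length init) (subst₂ _≤_ (+-comm 1 i) (sym length≡) i<2^j)

rowList-bounded : ∀ j w → suc w < 2 ^ j → All (_≤ j) (rowList w)
rowList-bounded zero    w (s≤s ())
rowList-bounded (suc j) w 1+w<2^[1+j] with suc w <? 2 ^ j
... | yes 1+w<2^j = All.map m≤n⇒m≤1+n (rowList-bounded j w 1+w<2^j)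
... | no  1+w≮2^j with m≤n⇒∃[o]m+o≡n (≮⇒≥ 1+w≮2^j)
...   | i , 2^j+i≡1+w =
  subst (λ u → All (_≤ suc j) (rowList u)) w≡ (rowList-bounded-level j i i<2^j)
  where
  w≡ : (2 ^ j ∸ 1) + i ≡ w
  w≡ = trans (sym (+-∸-comm i (m^n>0 2 j))) (cong (_∸ 1) 2^j+i≡1+w)
  i<2^j : i < 2 ^ j
  i<2^j = +-cancelˡ-< (2 ^ j) i (2 ^ j)
            (subst₂ _<_ (sym 2^j+i≡1+w) (cong (2 ^ j +_) (+-identityʳ (2 ^ j))) 1+w<2^[1+j])

count-toList : ∀ {y} k (v : Vec ℕ y) → count (_≟ k) v ≡ occurrences k (toList v)
count-toList k Vec.[]      = refl
count-toList k (x Vec.∷ v) with x ≡ᵇ k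
... | true  = cong suc (count-toList k v)
... | false = count-toList k v

lookup-fromℕ-∷ʳ : ∀ {y} (v : Vec ℕ (suc y)) xs a → toList v ≡ xs ++ [ a ] → lookup v (fromℕ y) ≡ a
lookup-fromℕ-∷ʳ {zero}  (x Vec.∷ Vec.[]) []           a refl = refl
lookup-fromℕ-∷ʳ {zero}  (x Vec.∷ Vec.[]) (_ ∷ [])     a ()
lookup-fromℕ-∷ʳ {zero}  (x Vec.∷ Vec.[]) (_ ∷ _ ∷ _)  a ()
lookup-fromℕ-∷ʳ {suc y} (x Vec.∷ _ Vec.∷ _) []        a ()
lookup-fromℕ-∷ʳ {suc y} (x Vec.∷ v)      (_ ∷ xs)     a eq = lookup-fromℕ-∷ʳ v xs a (∷-injectiveʳ eq)

T-last : ∀ y → T 1 (suc y) y ≡ lookup (rowV 1 y) (fromℕ y)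
T-last y = lookup-toℕ-cong (rowV 1 y)
  (trans (toℕ-fromℕ< _) (trans (m<n⇒m%n≡m (n<1+n y)) (sym (toℕ-fromℕ y))))

T-diagonal-bounded : ∀ j w → suc w < 2 ^ j → T 1 (suc w) w ≤ j
T-diagonal-bounded j w 1+w<2^j = lookup⁺ (toList⁻ (rowList-bounded j w 1+w<2^j)) _

T-last-doubling : ∀ j → T 1 (suc (2 ^ j ∸ 1)) (2 ^ j ∸ 1) ≡ suc j
T-last-doubling j with doubling-∷ʳ j
... | init , eq , _ =
  trans (T-last y) (lookup-fromℕ-∷ʳ (rowV 1 y) init (suc j) (trans (rowList-doubling j) eq))
  where y = 2 ^ j ∸ 1

countRow-doubling : ∀ j k → countRow 1 (suc (2 ^ j ∸ 1)) (suc k) ≡ j C k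
countRow-doubling j k = begin
  count (_≟ suc k) (rowV 1 (2 ^ j ∸ 1))          ≡⟨ count-toList (suc k) (rowV 1 (2 ^ j ∸ 1)) ⟩
  occurrences (suc k) (rowList (2 ^ j ∸ 1))      ≡⟨ cong (occurrences (suc k)) (rowList-doubling j) ⟩
  occurrences (suc k) (doubling j)               ≡⟨ occurrences-doubling j k ⟩
  j C k                                          ∎
  where open ≡-Reasoning

proposition14 : ∀ (n k : ℕ) → 1 ≤ n → 1 ≤ k →
    ∃[ x ] (IsFirstRow 1 n x × countRow 1 x k ≡ (n ∸ 1) C (k ∸ 1))
proposition14 (suc j) (suc k) _ _ =
  suc (2 ^ j ∸ 1) , (s≤s z≤n , T-last-doubling j , earlier≢) , countRow-doubling j k
  where
  earlier≢ : ∀ z → 1 ≤ z → z < suc (2 ^ j ∸ 1) → ¬ (T 1 z (z ∸ 1) ≡ suc j)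
  earlier≢ (suc w) _ 1+w<1+y eq = 1+n≰n (subst (_≤ j) eq (T-diagonal-bounded j w 1+w<2^j))
    where
    1+w<2^j : suc w < 2 ^ j
    1+w<2^j = subst (suc w <_) (suc-pred (2 ^ j) ⦃ m^n≢0 2 j ⦄) 1+w<1+y
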